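{- There exists an effective topological space $(\mathcal{X},\tau,\mathcal{B})$ for which there is no oracle Turing machine $M$ that, given any K-name $(k,p)$ of any computable point $x\in X_c$ (the number $k$ as input and $p$ as oracle), halts and outputs a Markov name of $x$.
   Context: Let $(\varphi_e)_{e\in\mathbb{N}}$ be a standard effective enumeration of the partial computable functions on $\mathbb{N}$, and $W_e=\mathrm{dom}(\varphi_e)$. An effective topological space is a triple $(\mathcal{X},\tau,\mathcal{B})$ where $(\mathcal{X},\tau)$ is a non-empty topological space and $\mathcal{B}=(\mathcal{B}_i)_{i\in\mathbb{N}}$ is a numbered basis of $\tau$ such that there is a total computable $f:\mathbb{N}^2\to\mathbb{N}$ with $\mathcal{B}_i\cap\mathcal{B}_j=\bigcup_{k\in W_{f(i,j)}}\mathcal{B}_k$ for all $i,j$. A Type-2 name of $x\in\mathcal{X}$ is any $p\in\mathbb{N}^{\mathbb{N}}$ with $\{p(n):n\in\mathbb{N}\}=\{i: x\in\mathcal{B}_i\}$. A point is computable if it has a computable Type-2 name; $X_c$ denotes the set of computable points. A Markov name of $x\in X_c$ is any $e$ such that $\varphi_e$ is total and is a Type-2 name of $x$. The Kolmogorov complexity $K(x)$ of $x\in X_c$ is the length of a shortest program computing a Type-2 name of $x$ (whether plain, prefix-free or monotone machines are used does not matter). A K-name of $x\in X_c$ is a pair $(k,p)$ where $k\in\mathbb{N}$, $k\geq K(x)$, and $p$ is a Type-2 name of $x$ ($p$ need not be computable). -}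

module Defs where

open import Data.Nat using (ℕ; zero; suc; _+_; _*_; _∸_; _^_; _≤_; _<_)
open import Data.Nat.Logarithm using (⌊log₂_⌋)
open import Data.Product using (Σ; _×_; _,_)
open import Relation.Binary.PropositionalEquality using (_≡_)

⟨_,_⟩ : ℕ → ℕ → ℕ
⟨ a , b ⟩ = 2 ^ a * (suc (2 * b)) ∸ 1

-- Oracle μ-recursive programs (unary, with pairing); a Turing-complete
-- model of (oracle) computation.

data Prog : Set where
  zer suc′ idP fstP sndP orc : Prog
  comp : Prog → Prog → Prog   -- comp f g = f ∘ g
  prd  : Prog → Prog → Prog   -- x ↦ ⟨ f x , g x ⟩
  rec  : Prog → Prog → Prog   -- primitive recursion on ⟨ a , n ⟩
  mu   : Prog → Prog

data Eval (p : ℕ → ℕ) : Prog → ℕ → ℕ → Set where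
  ev-zer : ∀ {x} → Eval p zer x 0
  ev-suc : ∀ {x} → Eval p suc′ x (suc x)
  ev-id  : ∀ {x} → Eval p idP x x
  ev-fst : ∀ {a b} → Eval p fstP ⟨ a , b ⟩ a
  ev-snd : ∀ {a b} → Eval p sndP ⟨ a , b ⟩ b
  ev-orc : ∀ {x} → Eval p orc x (p x)
  ev-comp : ∀ {f g x y z} → Eval p g x y → Eval p f y z → Eval p (comp f g) x z
  ev-prd  : ∀ {f g x y z} → Eval p f x y → Eval p g x z → Eval p (prd f g) x ⟨ y , z ⟩
  ev-rec0 : ∀ {f g a y} → Eval p f a y → Eval p (rec f g) ⟨ a , 0 ⟩ y
  ev-recS : ∀ {f g a n y z} → Eval p (rec f g) ⟨ a , n ⟩ y →
            Eval p g ⟨ a , ⟨ n , y ⟩ ⟩ z → Eval p (rec f g) ⟨ a , suc n ⟩ z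
  ev-mu   : ∀ {f x n} → Eval p f ⟨ x , n ⟩ 0 →
            (∀ m → m < n → Σ ℕ (λ y → Eval p f ⟨ x , m ⟩ (suc y))) →
            Eval p (mu f) x n

code : Prog → ℕ
code zer = ⟨ 0 , 0 ⟩
code suc′ = ⟨ 1 , 0 ⟩
code idP = ⟨ 2 , 0 ⟩
code fstP = ⟨ 3 , 0 ⟩
code sndP = ⟨ 4 , 0 ⟩
code orc = ⟨ 5 , 0 ⟩
code (comp f g) = ⟨ 6 , ⟨ code f , code g ⟩ ⟩
code (prd f g) = ⟨ 7 , ⟨ code f , code g ⟩ ⟩
code (rec f g) = ⟨ 8 , ⟨ code f , code g ⟩ ⟩
code (mu f) = ⟨ 9 , code f ⟩

-- The standard enumeration: φ_e(x) = y  (non-codes give the empty function;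
-- the oracle is irrelevant for plain computation, fixed to λ _ → 0).
φ : ℕ → ℕ → ℕ → Set
φ e x y = Σ Prog (λ P → code P ≡ e × Eval (λ _ → 0) P x y)

_↓φ_ : ℕ → ℕ → Set
e ↓φ x = Σ ℕ (λ y → φ e x y)

_∈W_ : ℕ → ℕ → Set
k ∈W e = e ↓φ k

Total : ℕ → Set
Total e = ∀ x → e ↓φ x

len : ℕ → ℕ
len e = ⌊log₂ (suc e) ⌋

-- Effective topological spaces: the topology τ is the one generated by
-- the numbered basis B (B must cover X; the intersection condition is
-- witnessed by a total computable f).

record EffSpace : Set₁ where
  field
    Carrier  : Set
    point    : Carrier
    _∈B_     : Carrier → ℕ → Set
    cover    : ∀ x → Σ ℕ (λ i → x ∈B i)
    f        : ℕ → ℕ → ℕ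
    f-comp   : Σ ℕ (λ e → ∀ i j → φ e ⟨ i , j ⟩ (f i j))
    f-inter₁ : ∀ i j x → x ∈B i → x ∈B j → Σ ℕ (λ k → k ∈W f i j × x ∈B k)
    f-inter₂ : ∀ i j x k → k ∈W f i j → x ∈B k → x ∈B i × x ∈B j

module _ (S : EffSpace) where
  open EffSpace S

  Type2Name : Carrier → (ℕ → ℕ) → Set
  Type2Name x p = ∀ i → (x ∈B i → Σ ℕ (λ n → p n ≡ i)) × (Σ ℕ (λ n → p n ≡ i) → x ∈B i)

  NameGraph : Carrier → ℕ → Set
  NameGraph x e = ∀ i → (x ∈B i → Σ ℕ (λ n → φ e n i)) × (Σ ℕ (λ n → φ e n i) → x ∈B i)

  MarkovName : ℕ → Carrier → Set
  MarkovName e x = Total e × NameGraph x e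

  ComputablePt : Carrier → Set
  ComputablePt x = Σ ℕ (λ e → MarkovName e x)

  IsK : Carrier → ℕ → Set
  IsK x n = Σ ℕ (λ e → len e ≡ n × MarkovName e x) × (∀ e → MarkovName e x → n ≤ len e)

  KBound : Carrier → ℕ → Set
  KBound x k = Σ ℕ (λ n → IsK x n × n ≤ k)

  KName : Carrier → ℕ → (ℕ → ℕ) → Set
  KName x k p = KBound x k × Type2Name x p

module Submission where

-- The witness is a Sierpiński space: points false and true, basis B₀ = {true}
-- and Bᵢ = {false , true} for i ≥ 1.  Names of true enumerate ℕ, names of false
-- enumerate ℕ ∖ {0}, and K(false) = 1, K(true) = 2.
--
-- Oracle computations are continuous: a halting run reads a finite prefix of
-- the oracle.  A converter M run on the K-name (2 , suc) of false halts with a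
-- Markov name e of false after reading the oracle below some N.  Agreeing with
-- suc below N and enumerating ℕ afterwards gives a name of true, on which the
-- deterministic M outputs the same e; but no index names both points, as 0 is
-- listed by every name of true and by none of false.

open import Defs
open import Data.Bool using (Bool; true; false)
open import Data.Nat using (ℕ; zero; suc; _+_; _*_; _∸_; _^_; _≤_; _<_; z≤n; s≤s; _⊔_; _<?_)
open import Data.Nat.Logarithm using (⌊log₂⌋-mono-≤; ⌊log₂[2^n]⌋≡n)
open import Data.Nat.Properties
open import Data.Product using (Σ; _×_; _,_; proj₁; proj₂; map₁)
open import Data.Sum using (inj₁; inj₂)
open import Data.Unit using (⊤; tt)
open import Relation.Binary using (tri<; tri≈; tri>)
open import Relation.Binary.PropositionalEquality
open import Relation.Nullary using (¬_; yes; no; contradiction)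

-- ⟨ a , b ⟩ = 2^a (2b+1) - 1; injectivity is uniqueness of the decomposition
-- of a positive number as a power of two times an odd number.
pow2odd : ℕ → ℕ → ℕ
pow2odd a b = 2 ^ a * suc (2 * b)

pow2odd-positive : ∀ a b → 1 ≤ pow2odd a b
pow2odd-positive a b = *-mono-≤ (m^n>0 2 a) (s≤s z≤n)

pow2odd-zero : ∀ b → pow2odd 0 b ≡ suc (2 * b)
pow2odd-zero b = *-identityˡ (suc (2 * b))

pow2odd-suc : ∀ a b → pow2odd (suc a) b ≡ 2 * pow2odd a b
pow2odd-suc a b = *-assoc 2 (2 ^ a) (suc (2 * b))

pow2odd-injective : ∀ a b c d → pow2odd a b ≡ pow2odd c d → a ≡ c × b ≡ d
pow2odd-injective zero b zero d eq =
  refl , *-cancelˡ-≡ b d 2 (suc-injective (trans (sym (pow2odd-zero b)) (trans eq (pow2odd-zero d))))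
pow2odd-injective zero b (suc c) d eq =
  contradiction (trans (sym (pow2odd-suc c d)) (trans (sym eq) (pow2odd-zero b))) (even≢odd (pow2odd c d) b)
pow2odd-injective (suc a) b zero d eq =
  contradiction (trans (sym (pow2odd-suc a b)) (trans eq (pow2odd-zero d))) (even≢odd (pow2odd a b) d)
pow2odd-injective (suc a) b (suc c) d eq =
  map₁ (cong suc) (pow2odd-injective a b c d
    (*-cancelˡ-≡ _ _ 2 (trans (sym (pow2odd-suc a b)) (trans eq (pow2odd-suc c d)))))

pair-injective : ∀ {a b c d} → ⟨ a , b ⟩ ≡ ⟨ c , d ⟩ → a ≡ c × b ≡ d
pair-injective {a} {b} {c} {d} eq =
  pow2odd-injective a b c d (∸-cancelʳ-≡ (pow2odd-positive a b) (pow2odd-positive c d) eq)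

tag : Prog → ℕ
tag zer = 0
tag suc′ = 1
tag idP = 2
tag fstP = 3
tag sndP = 4
tag orc = 5
tag (comp f g) = 6
tag (prd f g) = 7
tag (rec f g) = 8
tag (mu f) = 9

body : Prog → ℕ
body (comp f g) = ⟨ code f , code g ⟩
body (prd f g) = ⟨ code f , code g ⟩
body (rec f g) = ⟨ code f , code g ⟩
body (mu f) = code f
body _ = 0

code-split : ∀ P → code P ≡ ⟨ tag P , body P ⟩
code-split zer = refl
code-split suc′ = refl
code-split idP = refl
code-split fstP = refl
code-split sndP = refl
code-split orc = refl
code-split (comp f g) = refl
code-split (prd f g) = refl
code-split (rec f g) = refl
code-split (mu f) = refl

code-injective : ∀ P Q → code P ≡ code Q → P ≡ Q
same-tag-body : ∀ P Q → tag P ≡ tag Q → body P ≡ body Q → P ≡ Q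

code-injective P Q eq =
  let tags , bodies = pair-injective (trans (sym (code-split P)) (trans eq (code-split Q)))
  in same-tag-body P Q tags bodies

same-tag-body zer zer refl _ = refl
same-tag-body suc′ suc′ refl _ = refl
same-tag-body idP idP refl _ = refl
same-tag-body fstP fstP refl _ = refl
same-tag-body sndP sndP refl _ = refl
same-tag-body orc orc refl _ = refl
same-tag-body (comp f g) (comp f′ g′) refl eq =
  let ef , eg = pair-injective eq in cong₂ comp (code-injective f f′ ef) (code-injective g g′ eg)
same-tag-body (prd f g) (prd f′ g′) refl eq =
  let ef , eg = pair-injective eq in cong₂ prd (code-injective f f′ ef) (code-injective g g′ eg)
same-tag-body (rec f g) (rec f′ g′) refl eq =
  let ef , eg = pair-injective eq in cong₂ rec (code-injective f f′ ef) (code-injective g g′ eg)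
same-tag-body (mu f) (mu f′) refl eq = cong mu (code-injective f f′ eq)

φ-code : ∀ P {x y} → φ (code P) x y → Eval (λ _ → 0) P x y
φ-code P {x} {y} (Q , eq , run) = subst (λ R → Eval (λ _ → 0) R x y) (code-injective Q P eq) run

-- Oracle evaluation is deterministic.  Stated up to an equation between the
-- inputs, so that runs on inputs given by different pairing patterns compare.
eval-det : ∀ {p P x x′ y z} → Eval p P x y → Eval p P x′ z → x ≡ x′ → y ≡ z
eval-det ev-zer ev-zer _ = refl
eval-det ev-suc ev-suc eq = cong suc eq
eval-det ev-id ev-id eq = eq
eval-det (ev-fst {a} {b}) (ev-fst {c} {d}) eq = proj₁ (pair-injective {a} {b} {c} {d} eq)
eval-det (ev-snd {a} {b}) (ev-snd {c} {d}) eq = proj₂ (pair-injective {a} {b} {c} {d} eq)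
eval-det {p} ev-orc ev-orc eq = cong p eq
eval-det (ev-comp d₁ d₂) (ev-comp e₁ e₂) eq = eval-det d₂ e₂ (eval-det d₁ e₁ eq)
eval-det (ev-prd d₁ d₂) (ev-prd e₁ e₂) eq = cong₂ ⟨_,_⟩ (eval-det d₁ e₁ eq) (eval-det d₂ e₂ eq)
eval-det (ev-rec0 {a = a} d) (ev-rec0 {a = a′} e) eq = eval-det d e (proj₁ (pair-injective {a} {0} {a′} {0} eq))
eval-det (ev-rec0 {a = a} _) (ev-recS {a = a′} {n = n′} _ _) eq
  with () ← proj₂ (pair-injective {a} {0} {a′} {suc n′} eq)
eval-det (ev-recS {a = a} {n = n} _ _) (ev-rec0 {a = a′} _) eq
  with () ← proj₂ (pair-injective {a} {suc n} {a′} {0} eq)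
eval-det (ev-recS {a = a} {n = n} d₁ d₂) (ev-recS {a = a′} {n = n′} e₁ e₂) eq
  with pair-injective {a} {suc n} {a′} {suc n′} eq
... | refl , refl with refl ← eval-det d₁ e₁ refl = eval-det d₂ e₂ refl
-- the output of μ is the least zero, so neither search can stop before the other
eval-det (ev-mu {n = n} d below) (ev-mu {n = n′} d′ below′) refl with <-cmp n n′
... | tri< n<n′ _ _ with () ← eval-det d (proj₂ (below′ n n<n′)) refl
... | tri≈ _ n≡n′ _ = n≡n′
... | tri> _ _ n′<n with () ← eval-det (proj₂ (below n′ n′<n)) d′ refl

eval-functional : ∀ {p P x y z} → Eval p P x y → Eval p P x z → y ≡ z
eval-functional d e = eval-det d e refl

AgreeBelow : (ℕ → ℕ) → (ℕ → ℕ) → ℕ → Set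
AgreeBelow p q N = ∀ n → n < N → q n ≡ p n

Stable : (ℕ → ℕ) → ((ℕ → ℕ) → Set) → Set
Stable p A = Σ ℕ (λ N → ∀ q → AgreeBelow p q N → A q)

stable-map : ∀ {p} {A B : (ℕ → ℕ) → Set} → (∀ {q} → A q → B q) → Stable p A → Stable p B
stable-map f (N , hold) = N , λ q agree → f (hold q agree)

stable-× : ∀ {p} {A B : (ℕ → ℕ) → Set} → Stable p A → Stable p B → Stable p (λ q → A q × B q)
stable-× {p} (N , holdA) (M , holdB) =
  N ⊔ M , λ q agree → holdA q (shorten (m≤m⊔n N M) agree) , holdB q (shorten (m≤n⊔m N M) agree)
  where
  shorten : ∀ {q K L} → K ≤ L → AgreeBelow p q L → AgreeBelow p q K
  shorten K≤L agree n n<K = agree n (<-≤-trans n<K K≤L)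

stable-∀< : ∀ {p} {B : ℕ → (ℕ → ℕ) → Set} k →
            (∀ m → m < k → Stable p (B m)) → Stable p (λ q → ∀ m → m < k → B m q)
stable-∀< zero _ = 0 , λ _ _ _ ()
stable-∀< {B = B} (suc k) stable =
  stable-map extend (stable-× (stable-∀< k (λ m m<k → stable m (m<n⇒m<1+n m<k))) (stable k ≤-refl))
  where
  extend : ∀ {q} → (∀ m → m < k → B m q) × B k q → ∀ m → m < suc k → B m q
  extend (below , atk) m m<1+k with m≤n⇒m<n∨m≡n (≤-pred m<1+k)
  ... | inj₁ m<k = below m m<k
  ... | inj₂ refl = atk

eval-continuous : ∀ {p P x y} → Eval p P x y → Stable p (λ q → Eval q P x y)
eval-continuous ev-zer = 0 , λ _ _ → ev-zer
eval-continuous ev-suc = 0 , λ _ _ → ev-suc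
eval-continuous ev-id = 0 , λ _ _ → ev-id
eval-continuous (ev-fst {a} {b}) = 0 , λ _ _ → ev-fst {a = a} {b = b}
eval-continuous (ev-snd {a} {b}) = 0 , λ _ _ → ev-snd {a = a} {b = b}
eval-continuous (ev-orc {x}) = suc x , λ q agree → subst (Eval q orc x) (agree x ≤-refl) ev-orc
eval-continuous (ev-comp d₁ d₂) =
  stable-map (λ (e₁ , e₂) → ev-comp e₁ e₂) (stable-× (eval-continuous d₁) (eval-continuous d₂))
eval-continuous (ev-prd d₁ d₂) =
  stable-map (λ (e₁ , e₂) → ev-prd e₁ e₂) (stable-× (eval-continuous d₁) (eval-continuous d₂))
eval-continuous (ev-rec0 {a = a} d) = stable-map (ev-rec0 {a = a}) (eval-continuous d)
eval-continuous (ev-recS {a = a} {n = n} {y = y} d₁ d₂) =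
  stable-map (λ (e₁ , e₂) → ev-recS {a = a} {n = n} {y = y} e₁ e₂)
    (stable-× (eval-continuous d₁) (eval-continuous d₂))
eval-continuous (ev-mu {x = x} {n = n} d below) =
  stable-map (λ (e , below′) → ev-mu {x = x} e below′)
    (stable-× (eval-continuous d)
      (stable-∀< n (λ m m<n → stable-map (proj₁ (below m m<n) ,_) (eval-continuous (proj₂ (below m m<n))))))

module _ (S : EffSpace) where
  open EffSpace S

  Converter : Prog → Set
  Converter M = (x : Carrier) → ComputablePt S x → (k : ℕ) (p : ℕ → ℕ) → KName S x k p →
                Σ ℕ (λ e → Eval p M k e × MarkovName S e x)

  bounded-computable : ∀ {x k} → KBound S x k → ComputablePt S x
  bounded-computable (_ , ((e , _ , named) , _) , _) = e , named

  separated-names : ∀ {x y i e} → y ∈B i → ¬ x ∈B i → MarkovName S e x → ¬ MarkovName S e y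
  separated-names {i = i} y∈Bᵢ x∉Bᵢ (_ , graph-x) (_ , graph-y) =
    x∉Bᵢ (proj₂ (graph-x i) (proj₁ (graph-y i) y∈Bᵢ))

  -- If x and y share a complexity bound k and are separated by a basic open set,
  -- while some name of x is a limit of names of y, no converter exists: it would
  -- give x and y the same Markov name.
  no-converter : ∀ {x y i k p} → y ∈B i → ¬ x ∈B i → KBound S x k → KBound S y k →
                 Type2Name S x p → (∀ N → Σ (ℕ → ℕ) (λ q → AgreeBelow p q N × Type2Name S y q)) →
                 ¬ Σ Prog Converter
  no-converter {x} {y} {k = k} {p} y∈Bᵢ x∉Bᵢ bound-x bound-y name-x approximate (_ , convert) =
    let e , run-x , e-names-x = convert x (bounded-computable bound-x) k p (bound-x , name-x)
        N , runs-near-p = eval-continuous run-x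
        q , q≈p , name-y = approximate N
        e′ , run-y , e′-names-y = convert y (bounded-computable bound-y) k q (bound-y , name-y)
        e′≡e = eval-functional run-y (runs-near-p q q≈p)
    in separated-names y∈Bᵢ x∉Bᵢ e-names-x (subst (λ d → MarkovName S d y) e′≡e e′-names-y)

constP : ℕ → Prog
constP zero = zer
constP (suc n) = comp suc′ (constP n)

eval-constP : ∀ {p} n x → Eval p (constP n) x n
eval-constP zero x = ev-zer
eval-constP (suc n) x = ev-comp (eval-constP n x) ev-suc

caseZero : ℕ → ℕ → ℕ → ℕ
caseZero a b zero = a
caseZero a b (suc _) = b

caseZeroP : Prog → Prog → Prog
caseZeroP A B = comp (rec A B) (prd zer idP)

eval-caseZeroP : ∀ {p A B a b} → (∀ x → Eval p A x a) → (∀ x → Eval p B x b) →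
                 ∀ i → Eval p (caseZeroP A B) i (caseZero a b i)
eval-caseZeroP {p} {A} {B} {a} {b} runA runB i = ev-comp (ev-prd ev-zer ev-id) (on-pair i)
  where
  on-pair : ∀ i → Eval p (rec A B) ⟨ 0 , i ⟩ (caseZero a b i)
  on-pair zero = ev-rec0 (runA 0)
  on-pair (suc i) = ev-recS {a = 0} {n = i} {y = caseZero a b i} (on-pair i) (runB _)

-- An index whose domain is {0}: μn. fst ⟨ x , n ⟩ = 0 halts exactly when x = 0.
onlyZero : ℕ
onlyZero = code (mu fstP)

zero-∈W-onlyZero : 0 ∈W onlyZero
zero-∈W-onlyZero = 0 , mu fstP , refl , ev-mu {x = 0} (ev-fst {a = 0} {b = 0}) (λ _ ())

∈W-onlyZero : ∀ {k} → k ∈W onlyZero → k ≡ 0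
∈W-onlyZero {k} (_ , P , eq , run) with refl ← code-injective P (mu fstP) eq
  with ev-mu {n = n} found _ ← run = sym (eval-functional found (ev-fst {a = k} {b = n}))

-- Index 0 is the code of zer, a total function.
∈W-zero : ∀ k → k ∈W 0
∈W-zero k = 0 , zer , refl , ev-zer

-- A program computing the constant onlyZero = ⟨ 9 , 7 ⟩ without a long unary chain.
onlyZeroP : Prog
onlyZeroP = prd (constP 9) (constP 7)

eval-onlyZeroP : ∀ {p} x → Eval p onlyZeroP x onlyZero
eval-onlyZeroP x = ev-prd (eval-constP 9 x) (eval-constP 7 x)

_∈Sierp_ : Bool → ℕ → Set
true ∈Sierp _ = ⊤
false ∈Sierp i = 1 ≤ i

-- B_i ∩ B_j is B₀ when i or j is 0 (domain {0}) and the whole space otherwise (domain ℕ).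
interIndex : ℕ → ℕ → ℕ
interIndex i zero = onlyZero
interIndex i (suc _) = caseZero onlyZero 0 i

interP : Prog
interP = rec onlyZeroP (comp (caseZeroP onlyZeroP zer) fstP)

eval-interP : ∀ i j → Eval (λ _ → 0) interP ⟨ i , j ⟩ (interIndex i j)
eval-interP i zero = ev-rec0 (eval-onlyZeroP i)
eval-interP i (suc j) =
  ev-recS {a = i} {n = j} {y = interIndex i j} (eval-interP i j)
    (ev-comp (ev-fst {a = i} {b = ⟨ j , interIndex i j ⟩}) (eval-caseZeroP eval-onlyZeroP (λ _ → ev-zer) i))

zero-∈W-interIndex : ∀ i j → 0 ∈W interIndex i j
zero-∈W-interIndex i zero = zero-∈W-onlyZero
zero-∈W-interIndex zero (suc j) = zero-∈W-onlyZero
zero-∈W-interIndex (suc i) (suc j) = ∈W-zero 0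

false-∉-onlyZero : ∀ {k} → k ∈W onlyZero → ¬ false ∈Sierp k
false-∉-onlyZero k∈W 1≤k = <⇒≢ 1≤k (sym (∈W-onlyZero k∈W))

inter-cover : ∀ i j x → x ∈Sierp i → x ∈Sierp j → Σ ℕ (λ k → k ∈W interIndex i j × x ∈Sierp k)
inter-cover i j true _ _ = 0 , zero-∈W-interIndex i j , tt
inter-cover (suc i) (suc j) false _ _ = 1 , ∈W-zero 1 , s≤s z≤n

inter-sound : ∀ i j x k → k ∈W interIndex i j → x ∈Sierp k → x ∈Sierp i × x ∈Sierp j
inter-sound i j true _ _ _ = tt , tt
inter-sound (suc i) (suc j) false _ _ _ = s≤s z≤n , s≤s z≤n
inter-sound i zero false _ k∈W false∈Bₖ = contradiction false∈Bₖ (false-∉-onlyZero k∈W)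
inter-sound zero (suc j) false _ k∈W false∈Bₖ = contradiction false∈Bₖ (false-∉-onlyZero k∈W)

Sierpinski : EffSpace
Sierpinski = record
  { Carrier = Bool
  ; point = true
  ; _∈B_ = _∈Sierp_
  ; cover = λ { true → 0 , tt ; false → 1 , s≤s z≤n }
  ; f = interIndex
  ; f-comp = code interP , λ i j → interP , refl , eval-interP i j
  ; f-inter₁ = inter-cover
  ; f-inter₂ = inter-sound
  }

-- Index 1 = code suc′ enumerates ℕ ∖ {0}, a Markov name of false.
markov-false : MarkovName Sierpinski 1 false
markov-false = (λ x → suc x , suc′ , refl , ev-suc) , λ i → listed i , listed-in-B i
  where
  listed : ∀ i → 1 ≤ i → Σ ℕ (λ n → φ 1 n i)
  listed (suc i) _ = i , suc′ , refl , ev-suc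
  listed-in-B : ∀ i → Σ ℕ (λ n → φ 1 n i) → 1 ≤ i
  listed-in-B i (n , h) with ev-suc ← φ-code suc′ h = s≤s z≤n

-- Index 3 = code idP enumerates ℕ, a Markov name of true.
markov-true : MarkovName Sierpinski 3 true
markov-true = (λ x → x , idP , refl , ev-id) , λ i → (λ _ → i , idP , refl , ev-id) , (λ _ → tt)

len-lower : ∀ n e → 2 ^ n ≤ suc e → n ≤ len e
len-lower n e 2ⁿ≤1+e = subst (_≤ len e) (⌊log₂[2^n]⌋≡n n) (⌊log₂⌋-mono-≤ 2ⁿ≤1+e)

-- 2 = ⟨ 0 , 1 ⟩ is not the code of a program, since tag 0 forces body 0.
code≢2 : ∀ P → code P ≢ 2
code≢2 P eq =
  let tag≡0 , body≡1 = pair-injective {tag P} {body P} {0} {1} (trans (sym (code-split P)) eq)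
  in tag-zero-body P tag≡0 body≡1
  where
  tag-zero-body : ∀ P → tag P ≡ 0 → body P ≢ 1
  tag-zero-body zer refl ()

-- K(false) = 1: index 0 lists 0, which no name of false may do.
K-false : IsK Sierpinski false 1
K-false = (1 , ⌊log₂[2^n]⌋≡n 1 , markov-false) , shortest
  where
  shortest : ∀ e → MarkovName Sierpinski e false → 1 ≤ len e
  shortest zero (_ , graph) with () ← proj₂ (graph 0) (0 , zer , refl , ev-zer)
  shortest (suc e) _ = len-lower 1 (suc e) (s≤s (s≤s z≤n))

-- K(true) = 2: index 0 never lists 1, index 1 never lists 0, index 2 is no program.
K-true : IsK Sierpinski true 2
K-true = (3 , ⌊log₂[2^n]⌋≡n 2 , markov-true) , shortest
  where
  shortest : ∀ e → MarkovName Sierpinski e true → 2 ≤ len e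
  shortest 0 (_ , graph) with () ← φ-code zer (proj₂ (proj₁ (graph 1) tt))
  shortest 1 (_ , graph) with () ← φ-code suc′ (proj₂ (proj₁ (graph 0) tt))
  shortest 2 (total , _) = contradiction (proj₁ (proj₂ (proj₂ (total 0)))) (code≢2 (proj₁ (proj₂ (total 0))))
  shortest (suc (suc (suc e))) _ = len-lower 2 (suc (suc (suc e))) (s≤s (s≤s (s≤s (s≤s z≤n))))

name-false : Type2Name Sierpinski false suc
name-false i = listed i , listed-in-B i
  where
  listed : ∀ i → 1 ≤ i → Σ ℕ (λ n → suc n ≡ i)
  listed (suc i) _ = i , refl
  listed-in-B : ∀ i → Σ ℕ (λ n → suc n ≡ i) → 1 ≤ i
  listed-in-B _ (_ , refl) = s≤s z≤n

trueAfter : ℕ → ℕ → ℕ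
trueAfter N n with n <? N
... | yes _ = suc n
... | no _ = n ∸ N

trueAfter-agrees : ∀ N → AgreeBelow suc (trueAfter N) N
trueAfter-agrees N n n<N with n <? N
... | yes _ = refl
... | no n≮N = contradiction n<N n≮N

name-true : ∀ N → Type2Name Sierpinski true (trueAfter N)
name-true N i = (λ _ → N + i , lists-i) , (λ _ → tt)
  where
  lists-i : trueAfter N (N + i) ≡ i
  lists-i with N + i <? N
  ... | yes N+i<N = contradiction N+i<N (m+n≮m N i)
  ... | no _ = m+n∸m≡n N i

mainTheorem1 : Σ EffSpace (λ S → ¬ (Σ Prog (λ M →
                 (x : EffSpace.Carrier S) → ComputablePt S x →
                 (k : ℕ) (p : ℕ → ℕ) → KName S x k p →
                 Σ ℕ (λ e → Eval p M k e × MarkovName S e x))))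
mainTheorem1 =
  Sierpinski ,
  no-converter Sierpinski {x = false} {y = true} {i = 0} {k = 2}
    tt (λ ()) (1 , K-false , s≤s z≤n) (2 , K-true , ≤-refl) name-false
    (λ N → trueAfter N , trueAfter-agrees N , name-true N)
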